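{- Let $p\geq 1$, $n\geq 1$, $i\in[1,n]$, and let $x,y$ be Fibonacci $p$-strings of length $n$ with $y=x+\delta_i$. Then for all $j\in[1,n]$ with $|i-j|>p$: $x+\delta_j$ is a Fibonacci $p$-string if and only if $y+\delta_j$ is a Fibonacci $p$-string.
   Context: For $p\geq 1$, a Fibonacci $p$-string of length $n$ is a binary string $u_1\ldots u_n$ in which any two 1s are separated by at least $p$ 0s. For a binary string $u$ of length $n$ and $j\in[1,n]$, $u+\delta_j$ denotes the string obtained from $u$ by flipping its $j$th coordinate. -}

module Defs where

open import Data.Nat using (ℕ; _<_; _+_; _∸_)
open import Data.Bool using (Bool; true; false; not)
open import Data.Fin using (Fin; toℕ)
open import Data.Vec.Functional using (Vector; updateAt)
open import Relation.Binary.PropositionalEquality using (_≡_)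

-- A binary string of length n: coordinates indexed by Fin n
-- (position k : Fin n corresponds to coordinate k+1 in [1,n]); true = 1, false = 0.
BinString : ℕ → Set
BinString n = Vector Bool n

-- Fibonacci p-string: any two 1s (at positions a < b) are separated by
-- at least p 0s, i.e. there are at least p positions strictly between them:
-- b - a - 1 ≥ p, equivalently p < b - a.
IsFibonacciString : (p : ℕ) {n : ℕ} → BinString n → Set
IsFibonacciString p {n} u =
  (a b : Fin n) → toℕ a < toℕ b → u a ≡ true → u b ≡ true →
  p < toℕ b ∸ toℕ a

-- u + δ_j : flip the j-th coordinate of u.
flipAt : {n : ℕ} → BinString n → Fin n → BinString n
flipAt u j = updateAt u j not

{-# OPTIONS --safe #-}
module Submission where

-- Flipping coordinate j only changes the pairs of 1s that contain j.  A pair avoiding j is a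
-- pair of 1s of y.  A pair {j, k} with k ≠ i reads the same bits in x + δ_j and y + δ_j,
-- since x and y differ only at i ≠ j.  The remaining pair {i, j} is far apart by hypothesis.
-- Swapping the roles of x and y gives the converse.

open import Defs
open import Level using (Level)
open import Data.Nat using (ℕ; _≥_; _<_; ∣_-_∣)
open import Data.Nat.Properties using (<-irrefl; <⇒≤; n≮0; ∣n-n∣≡0; m≤n⇒∣m-n∣≡n∸m; m≤n⇒∣n-m∣≡n∸m)
open import Data.Fin using (Fin; toℕ; _≟_)
open import Data.Vec.Functional using (Vector; updateAt)
open import Data.Vec.Functional.Properties using (updateAt-updates; updateAt-minimal)
open import Relation.Binary.PropositionalEquality using (_≡_; _≢_; refl; sym; trans; cong; subst)
open import Relation.Nullary using (yes; no)
open import Data.Bool using (not)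
open import Data.Empty using (⊥-elim)
open import Function.Bundles using (_⇔_; mk⇔)

private
  variable
    ℓ : Level
    A : Set ℓ
    n : ℕ

AgreeExcept : {A : Set ℓ} → Fin n → Vector A n → Vector A n → Set ℓ
AgreeExcept i xs ys = ∀ k → k ≢ i → xs k ≡ ys k

agreeExcept-sym : {i : Fin n} {xs ys : Vector A n} → AgreeExcept i xs ys → AgreeExcept i ys xs
agreeExcept-sym eq k k≢i = sym (eq k k≢i)

agreeExcept-updateAt : (i : Fin n) (f : A → A) (xs : Vector A n) →
  AgreeExcept i xs (updateAt xs i f)
agreeExcept-updateAt i f xs k k≢i = sym (updateAt-minimal k i xs k≢i)

updateAt-agreeExcept : {i : Fin n} {xs ys : Vector A n} (j : Fin n) (f : A → A) →
  AgreeExcept i xs ys → AgreeExcept i (updateAt xs j f) (updateAt ys j f)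
updateAt-agreeExcept {xs = xs} {ys} j f eq k k≢i with k ≟ j
... | yes refl = trans (updateAt-updates k xs) (trans (cong f (eq k k≢i)) (sym (updateAt-updates k ys)))
... | no k≢j   = trans (updateAt-minimal k j xs k≢j) (trans (eq k k≢i) (sym (updateAt-minimal k j ys k≢j)))

far⇒≢ : (p : ℕ) (i j : Fin n) → p < ∣ toℕ i - toℕ j ∣ → j ≢ i
far⇒≢ p i .i far refl = n≮0 (subst (p <_) (∣n-n∣≡0 (toℕ i)) far)

isFibonacciString-flipAt-transfer : (p : ℕ) (i j : Fin n) (x y : BinString n) →
  AgreeExcept i x y → p < ∣ toℕ i - toℕ j ∣ →
  IsFibonacciString p y → IsFibonacciString p (flipAt x j) → IsFibonacciString p (flipAt y j)
isFibonacciString-flipAt-transfer p i j x y eq far yF xjF a b a<b ya yb with a ≟ j | b ≟ j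
... | yes refl | yes refl = ⊥-elim (<-irrefl refl a<b)
... | no a≢j   | no b≢j   =
  yF a b a<b (trans (sym (updateAt-minimal a j y a≢j)) ya) (trans (sym (updateAt-minimal b j y b≢j)) yb)
... | yes refl | no b≢j with b ≟ i
...   | yes refl = subst (p <_) (m≤n⇒∣n-m∣≡n∸m (<⇒≤ a<b)) far
...   | no b≢i   = xjF a b a<b (trans (flipped-agree a (far⇒≢ p i j far)) ya) (trans (flipped-agree b b≢i) yb)
  where
  flipped-agree : AgreeExcept i (flipAt x j) (flipAt y j)
  flipped-agree = updateAt-agreeExcept j not eq
isFibonacciString-flipAt-transfer p i j x y eq far yF xjF a b a<b ya yb | no a≢j | yes refl with a ≟ i
...   | yes refl = subst (p <_) (m≤n⇒∣m-n∣≡n∸m (<⇒≤ a<b)) far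
...   | no a≢i   = xjF a b a<b (trans (flipped-agree a a≢i) ya) (trans (flipped-agree b (far⇒≢ p i j far)) yb)
  where
  flipped-agree : AgreeExcept i (flipAt x j) (flipAt y j)
  flipped-agree = updateAt-agreeExcept j not eq

proposition7p4 : (p n : ℕ) → p ≥ 1 → n ≥ 1 → (i : Fin n) →
    (x y : BinString n) → IsFibonacciString p x → IsFibonacciString p y →
    y ≡ flipAt x i →
    (j : Fin n) → p < ∣ toℕ i - toℕ j ∣ →
    (IsFibonacciString p (flipAt x j) ⇔ IsFibonacciString p (flipAt y j))
proposition7p4 p n _ _ i x .(flipAt x i) xF yF refl j far =
  mk⇔ (isFibonacciString-flipAt-transfer p i j x y x≈y far yF)
      (isFibonacciString-flipAt-transfer p i j y x (agreeExcept-sym x≈y) far xF)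
  where
  y = flipAt x i
  x≈y : AgreeExcept i x y
  x≈y = agreeExcept-updateAt i not x
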